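{- Let $d$ be a positive integer. (i) The poset $\mathcal{P}_d=(\Lambda_d,\prec)$ is the disjoint union of its subposets $\Lambda_{d,1},\dots,\Lambda_{d,d}$, i.e. these sets partition $\Lambda_d$ and no element of $\Lambda_{d,k}$ is comparable with an element of $\Lambda_{d,k'}$ for $k\neq k'$. (ii) For each $k\in\{1,\dots,d\}$, the poset $\mathcal{P}_{d,k}$ (the set $\Lambda_{d,k}$ with the restriction of $\prec$) is indecomposable, i.e. it is not the disjoint union of two nonempty subposets with no comparabilities between them.
   Context: $\Lambda_d=\mathbb{Z}_{\geq0}^d$ with basis $\mathbf{e}(1),\dots,\mathbf{e}(d)$; $X_d=\{\mathbf{e}(k)-\mathbf{e}(i)-\mathbf{e}(j): i,j,k\in\{1,\dots,d\},\ d\mid k-i-j\}$; for $\mathbf{v},\mathbf{w}\in\Lambda_d$, $\mathbf{v}\lessdot\mathbf{w}$ iff $\mathbf{v}-\mathbf{w}\in X_d$; $\prec$ is the transitive closure of $\lessdot$ on $\Lambda_d$ (chains staying in $\Lambda_d$). For $k=1,\dots,d$, $\Lambda_{d,k}$ is the set of $\mathbf{v}=(v_1,\dots,v_d)\in\Lambda_d$ such that $d$ divides $v_1+2v_2+\dots+dv_d-k$. -}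

module Defs where

open import Data.Nat using (ℕ; suc; _*_)
open import Data.Nat.ListAction using (sum)
open import Data.Fin using (Fin; toℕ; _≟_)
open import Data.List using (map; allFin)
open import Data.Integer as ℤ using (ℤ; +_; _-_)
open import Data.Integer.Divisibility using (_∣_)
open import Data.Product using (∃; _×_)
open import Relation.Nullary using (Dec; yes; no)
open import Relation.Binary.PropositionalEquality using (_≡_)
open import Relation.Binary.Construct.Closure.Transitive using (TransClosure)

-- Λ_d = ℤ_{≥0}^d : vectors indexed by Fin d.  Coordinate l : Fin d is the
-- paper's coordinate (toℕ l + 1) ∈ {1,…,d}.
Λ : ℕ → Set
Λ d = Fin d → ℕ

ix : ∀ {d} → Fin d → ℤ
ix l = + suc (toℕ l)

δ : ∀ {d} → Fin d → Fin d → ℤ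
δ i l with i ≟ l
... | yes _ = + 1
... | no  _ = + 0

_⋖_ : ∀ {d} → Λ d → Λ d → Set
_⋖_ {d} v w = ∃ λ (k : Fin d) → ∃ λ (i : Fin d) → ∃ λ (j : Fin d) →
  ((+ d) ∣ (ix k - ix i - ix j)) ×
  (∀ (l : Fin d) → (+ v l) - (+ w l) ≡ δ k l - δ i l - δ j l)

_≺_ : ∀ {d} → Λ d → Λ d → Set
_≺_ = TransClosure _⋖_

weight : ∀ {d} → Λ d → ℕ
weight {d} v = sum (map (λ l → suc (toℕ l) * v l) (allFin d))

InΛ : ∀ {d} → Fin d → Λ d → Set
InΛ {d} k v = (+ d) ∣ ((+ weight v) - ix k)

-- The weight v₁ + 2v₂ + ⋯ + d·v_d changes by k − i − j ≡ 0 (mod d) along a cover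
-- step v ⋖ w, so each block Λ_{d,k} is a union of components of the comparability
-- graph; with the fact that 1, …, d are distinct mod d this gives (i).
-- For (ii) every block is connected: since d ∣ d − d − d we have v ⋖ v + e(d), so 0 is
-- connected to e(d); steps are translation invariant, so v ~ e(c) gives
-- v + e(b) ~ e(c) + e(b), which covers e(a) for a ≡ b + c.  By induction every v is
-- connected to some e(c), and then c is the block index of v.  In a splitting of a
-- connected block into two parts without comparabilities, membership in one part
-- would propagate along single steps, so one part is empty.

module Submission where

open import Defs
open import Level using (0ℓ)
open import Data.Nat as ℕ using (ℕ; zero; suc; _<_; NonZero)
import Data.Nat.Properties as ℕP
open import Algebra.Properties.CommutativeSemigroup ℕP.+-commutativeSemigroup
  using () renaming (interchange to +-interchange)
import Data.Nat.Divisibility as ℕD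
open import Data.Nat.ListAction using (sum)
open import Data.Fin using (Fin; zero; suc; toℕ; _≟_; fromℕ; fromℕ<)
import Data.Fin.Properties as FP
open import Data.Vec.Functional using (head; tail) renaming (_∷_ to _∷ᶠ_)
open import Data.List using (List; []; _∷_; map; allFin; tabulate)
import Data.List.Properties as LP
open import Data.Integer using (ℤ; +_; _-_; _+_; _*_; -_; ∣_∣)
import Data.Integer.Properties as ℤP
open import Data.Integer.Divisibility using (_∣_)
import Data.Integer.Divisibility.Signed as S
open import Data.Integer.DivMod using (_%ℕ_; _/ℕ_; n%ℕd<d; a≡a%ℕn+[a/ℕn]*n)
open import Data.Integer.Tactic.RingSolver using (solve-∀)
open import Data.Product using (Σ; ∃; _×_; _,_; proj₁; proj₂)
open import Data.Sum using (_⊎_; inj₁; inj₂)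
open import Data.Empty using (⊥; ⊥-elim)
open import Function using (id; _∘_; _⇔_; mk⇔; Equivalence)
open import Function.Properties.Equivalence using (⇔-isEquivalence)
open import Relation.Nullary using (¬_; yes; no; contradiction)
open import Relation.Binary using (Rel; IsEquivalence)
open import Relation.Binary.PropositionalEquality
open import Relation.Binary.Construct.Closure.Transitive using (TransClosure; [_]; _∷_)
open import Relation.Binary.Construct.Closure.ReflexiveTransitive using (ε; _◅_; _◅◅_)
open import Relation.Binary.Construct.Closure.Symmetric using (fwd)
open import Relation.Binary.Construct.Closure.Equivalence
  using (EqClosure; gfold; gmap; return) renaming (symmetric to EqClosure-sym)


e : ∀ {d} → Fin d → Λ d
e zero    zero    = 1
e zero    (suc _) = 0
e (suc _) zero    = 0
e (suc i) (suc l) = e i l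

e-diag : ∀ {d} (i : Fin d) → e i i ≡ 1
e-diag zero    = refl
e-diag (suc i) = e-diag i

e-offdiag : ∀ {d} {i l : Fin d} → i ≢ l → e i l ≡ 0
e-offdiag {i = zero}  {zero}  i≢l = contradiction refl i≢l
e-offdiag {i = zero}  {suc l} i≢l = refl
e-offdiag {i = suc i} {zero}  i≢l = refl
e-offdiag {i = suc i} {suc l} i≢l = e-offdiag (i≢l ∘ cong suc)

δ≡e : ∀ {d} (i l : Fin d) → δ i l ≡ + e i l
δ≡e i l with i ≟ l
... | yes refl = cong +_ (sym (e-diag i))
... | no  i≢l  = cong +_ (sym (e-offdiag i≢l))

infixl 6 _⊕_
_⊕_ : ∀ {d} → Λ d → Λ d → Λ d
(v ⊕ w) l = v l ℕ.+ w l

sum-map-+ : ∀ {A : Set} (f g : A → ℕ) (xs : List A) →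
  sum (map (λ x → f x ℕ.+ g x) xs) ≡ sum (map f xs) ℕ.+ sum (map g xs)
sum-map-+ f g []       = refl
sum-map-+ f g (x ∷ xs) = begin
  f x ℕ.+ g x ℕ.+ sum (map (λ x → f x ℕ.+ g x) xs)    ≡⟨ cong (f x ℕ.+ g x ℕ.+_) (sum-map-+ f g xs) ⟩
  f x ℕ.+ g x ℕ.+ (sum (map f xs) ℕ.+ sum (map g xs)) ≡⟨ +-interchange (f x) (g x) _ _ ⟩
  f x ℕ.+ sum (map f xs) ℕ.+ (g x ℕ.+ sum (map g xs)) ∎
  where open ≡-Reasoning

weight-cong : ∀ {d} {v w : Λ d} → v ≗ w → weight v ≡ weight w
weight-cong {d} v≗w = cong sum (LP.map-cong (λ l → cong (suc (toℕ l) ℕ.*_) (v≗w l)) (allFin d))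

weight-⊕ : ∀ {d} (v w : Λ d) → weight (v ⊕ w) ≡ weight v ℕ.+ weight w
weight-⊕ {d} v w = trans
  (cong sum (LP.map-cong (λ l → ℕP.*-distribˡ-+ (suc (toℕ l)) (v l) (w l)) (allFin d)))
  (sum-map-+ (λ l → suc (toℕ l) ℕ.* v l) (λ l → suc (toℕ l) ℕ.* w l) (allFin d))

sum-tabulate-*0 : ∀ {n} (f : Fin n → ℕ) → sum (tabulate (λ l → f l ℕ.* 0)) ≡ 0
sum-tabulate-*0 {zero}  f = refl
sum-tabulate-*0 {suc n} f = cong₂ ℕ._+_ (ℕP.*-zeroʳ (f zero)) (sum-tabulate-*0 (f ∘ suc))

sum-tabulate-*e : ∀ {n} (f : Fin n → ℕ) (c : Fin n) → sum (tabulate (λ l → f l ℕ.* e c l)) ≡ f c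
sum-tabulate-*e f zero = trans
  (cong₂ ℕ._+_ (ℕP.*-identityʳ (f zero)) (sum-tabulate-*0 (f ∘ suc)))
  (ℕP.+-identityʳ (f zero))
sum-tabulate-*e f (suc c) = cong₂ ℕ._+_ (ℕP.*-zeroʳ (f zero)) (sum-tabulate-*e (f ∘ suc) c)

weight-e : ∀ {d} (c : Fin d) → weight (e c) ≡ suc (toℕ c)
weight-e c = trans (cong sum (LP.map-tabulate id (λ l → suc (toℕ l) ℕ.* e c l)))
  (sum-tabulate-*e (suc ∘ toℕ) c)

weight-⊕e : ∀ {d} (v : Λ d) (c : Fin d) → weight (v ⊕ e c) ≡ weight v ℕ.+ suc (toℕ c)
weight-⊕e v c = trans (weight-⊕ v (e c)) (cong (weight v ℕ.+_) (weight-e c))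

infix 4 _≡_mod_
_≡_mod_ : ℤ → ℤ → ℕ → Set
_≡_mod_ a b n = + n ∣ a - b

≡-mod-refl : ∀ {n} {a} → a ≡ a mod n
≡-mod-refl {n} {a} = subst (λ x → n ℕD.∣ ∣ x ∣) (sym (ℤP.+-inverseʳ a)) (n ℕD.∣0)

≡-mod-sym : ∀ {n} {a b} → a ≡ b mod n → b ≡ a mod n
≡-mod-sym {n} {a} {b} = subst (n ℕD.∣_) (ℤP.∣i-j∣≡∣j-i∣ a b)

≡-mod-trans : ∀ {n} {a b c} → a ≡ b mod n → b ≡ c mod n → a ≡ c mod n
≡-mod-trans {n} {a} {b} {c} p q =
  S.∣⇒∣ᵤ (subst (+ n S.∣_) (telescope a b c)
    (S.∣m∣n⇒∣m+n (S.∣ᵤ⇒∣ {i = a - b} p) (S.∣ᵤ⇒∣ {i = b - c} q)))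
  where
  telescope : ∀ a b c → (a - b) + (b - c) ≡ a - c
  telescope = solve-∀

≡-mod-isEquivalence : ∀ n → IsEquivalence (λ a b → a ≡ b mod n)
≡-mod-isEquivalence n = record
  { refl  = λ {a} → ≡-mod-refl {n} {a}
  ; sym   = λ {a} {b} → ≡-mod-sym {n} {a} {b}
  ; trans = λ {a} {b} {c} → ≡-mod-trans {n} {a} {b} {c}
  }

m∣n∧n<m⇒n≡0 : ∀ {m n} → m ℕD.∣ n → n < m → n ≡ 0
m∣n∧n<m⇒n≡0 {n = zero}  _   _   = refl
m∣n∧n<m⇒n≡0 {n = suc n} m∣n n<m = contradiction (ℕD.∣⇒≤ m∣n) (ℕP.<⇒≱ n<m)

ix-injective-mod : ∀ {d} {k k′ : Fin d} → ix k ≡ ix k′ mod d → k ≡ k′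
ix-injective-mod {d} {k} {k′} d∣k-k′ =
  FP.toℕ-injective (ℕP.suc-injective (ℤP.+-injective (ℤP.i-j≡0⇒i≡j _ _ (ℤP.∣i∣≡0⇒i≡0
    (m∣n∧n<m⇒n≡0 d∣k-k′ ∣k-k′∣<d)))))
  where
  ∣k-k′∣<d : ∣ ix k - ix k′ ∣ < d
  ∣k-k′∣<d = subst (_< d)
    (cong ∣_∣ (sym (trans (ℤP.[+m]-[+n]≡m⊖n (suc (toℕ k)) (suc (toℕ k′)))
                          (ℤP.[1+m]⊖[1+n]≡m⊖n (toℕ k) (toℕ k′)))))
    (ℕP.≤-<-trans (ℤP.∣m⊝n∣≤m⊔n (toℕ k) (toℕ k′)) (ℕP.⊔-lub (FP.toℕ<n k) (FP.toℕ<n k′)))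

ix-surjective-mod : ∀ d .{{_ : NonZero d}} (a : ℤ) → ∃ λ (k : Fin d) → a ≡ ix k mod d
ix-surjective-mod d a = k , S.∣⇒∣ᵤ (S.divides ((a - + 1) /ℕ d) (begin
  a - ix k                 ≡⟨ cong (λ t → a - + suc t) (FP.toℕ-fromℕ< r<d) ⟩
  a - (+ 1 + + r)          ≡⟨ regroup a (+ r) ⟩
  (a - + 1) - + r          ≡⟨ cong (_- + r) (a≡a%ℕn+[a/ℕn]*n (a - + 1) d) ⟩
  + r + q * + d - + r      ≡⟨ cancel (+ r) (q * + d) ⟩
  q * + d                  ∎))
  where
  open ≡-Reasoning
  -- toℕ k = (a − 1) mod d, so ix k = 1 + (a − 1) mod d ∈ {1, …, d}
  r = (a - + 1) %ℕ d
  q = (a - + 1) /ℕ d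
  r<d = n%ℕd<d (a - + 1) d
  k = fromℕ< r<d
  regroup : ∀ a r → a - (+ 1 + r) ≡ (a - + 1) - r
  regroup = solve-∀
  cancel : ∀ r x → r + x - r ≡ x
  cancel = solve-∀

[+a]-[+b]≡[+x]-[+y]-[+z]⇔a+y+z≡b+x : ∀ a b x y z →
  (+ a - + b ≡ + x - + y - + z) ⇔ (a ℕ.+ y ℕ.+ z ≡ b ℕ.+ x)
[+a]-[+b]≡[+x]-[+y]-[+z]⇔a+y+z≡b+x a b x y z = mk⇔ to from
  where
  open ≡-Reasoning
  to : + a - + b ≡ + x - + y - + z → a ℕ.+ y ℕ.+ z ≡ b ℕ.+ x
  to eq = ℤP.+-injective (begin
    + a + + y + + z                         ≡⟨ split (+ a) (+ b) (+ y) (+ z) ⟩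
    (+ a - + b) + (+ b + + y + + z)         ≡⟨ cong (_+ (+ b + + y + + z)) eq ⟩
    (+ x - + y - + z) + (+ b + + y + + z)   ≡⟨ collect (+ b) (+ x) (+ y) (+ z) ⟩
    + b + + x                               ∎)
    where
    split : ∀ a b y z → a + y + z ≡ (a - b) + (b + y + z)
    split = solve-∀
    collect : ∀ b x y z → (x - y - z) + (b + y + z) ≡ b + x
    collect = solve-∀
  from : a ℕ.+ y ℕ.+ z ≡ b ℕ.+ x → + a - + b ≡ + x - + y - + z
  from eq = begin
    + a - + b                                         ≡⟨ split (+ a) (+ b) (+ x) (+ y) (+ z) ⟩
    (+ a + + y + + z) - (+ b + + x) + (+ x - + y - + z)
      ≡⟨ cong (λ t → t - (+ b + + x) + (+ x - + y - + z)) (cong +_ eq) ⟩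
    (+ b + + x) - (+ b + + x) + (+ x - + y - + z)     ≡⟨ cancel (+ b + + x) (+ x - + y - + z) ⟩
    + x - + y - + z                                   ∎
    where
    split : ∀ a b x y z → a - b ≡ (a + y + z) - (b + x) + (x - y - z)
    split = solve-∀
    cancel : ∀ s t → s - s + t ≡ t
    cancel = solve-∀

⋖-pointwise⇔ : ∀ {d} (v w : Λ d) (k i j l : Fin d) →
  (+ v l - + w l ≡ δ k l - δ i l - δ j l) ⇔ (v l ℕ.+ e i l ℕ.+ e j l ≡ w l ℕ.+ e k l)
⋖-pointwise⇔ v w k i j l
  rewrite δ≡e k l | δ≡e i l | δ≡e j l =
    [+a]-[+b]≡[+x]-[+y]-[+z]⇔a+y+z≡b+x (v l) (w l) (e k l) (e i l) (e j l)

⋖-intro : ∀ {d} {v w : Λ d} (k i j : Fin d) → ix k ≡ ix i + ix j mod d →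
  (∀ l → v l ℕ.+ e i l ℕ.+ e j l ≡ w l ℕ.+ e k l) → v ⋖ w
⋖-intro {d} {v} {w} k i j k≡i+j balanced =
  k , i , j , subst (+ d ∣_) (regroup (ix k) (ix i) (ix j)) k≡i+j ,
  λ l → Equivalence.from (⋖-pointwise⇔ v w k i j l) (balanced l)
  where
  regroup : ∀ a b c → a - (b + c) ≡ a - b - c
  regroup = solve-∀

weight-⋖ : ∀ {d} {v w : Λ d} → v ⋖ w → + weight v ≡ + weight w mod d
weight-⋖ {d} {v} {w} (k , i , j , d∣k-i-j , v-w≡δ) =
  subst (+ d ∣_) (sym weight-difference) d∣k-i-j
  where
  open ≡-Reasoning
  balanced : ∀ l → (v ⊕ e i ⊕ e j) l ≡ (w ⊕ e k) l
  balanced l = Equivalence.to (⋖-pointwise⇔ v w k i j l) (v-w≡δ l)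
  weight-difference : + weight v - + weight w ≡ ix k - ix i - ix j
  weight-difference = Equivalence.from
    ([+a]-[+b]≡[+x]-[+y]-[+z]⇔a+y+z≡b+x (weight v) (weight w) (suc (toℕ k)) (suc (toℕ i)) (suc (toℕ j)))
    (begin
      weight v ℕ.+ suc (toℕ i) ℕ.+ suc (toℕ j) ≡⟨ cong (ℕ._+ suc (toℕ j)) (weight-⊕e v i) ⟨
      weight (v ⊕ e i) ℕ.+ suc (toℕ j)         ≡⟨ weight-⊕e (v ⊕ e i) j ⟨
      weight (v ⊕ e i ⊕ e j)                   ≡⟨ weight-cong balanced ⟩
      weight (w ⊕ e k)                         ≡⟨ weight-⊕e w k ⟩
      weight w ℕ.+ suc (toℕ k)                 ∎)

⋖-translate : ∀ {d} {v w : Λ d} (u : Λ d) → v ⋖ w → (v ⊕ u) ⋖ (w ⊕ u)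
⋖-translate {v = v} {w} u (k , i , j , d∣k-i-j , v-w≡δ) =
  k , i , j , d∣k-i-j , λ l → trans (cancel (+ v l) (+ w l) (+ u l)) (v-w≡δ l)
  where
  cancel : ∀ a b c → (a + c) - (b + c) ≡ a - b
  cancel = solve-∀

Connected : ∀ {d} → Rel (Λ d) 0ℓ
Connected = EqClosure _⋖_

TransClosure⇒EqClosure : ∀ {A : Set} {R : Rel A 0ℓ} {x y} → TransClosure R x y → EqClosure R x y
TransClosure⇒EqClosure [ xRy ]      = return xRy
TransClosure⇒EqClosure (xRz ∷ z⁺y) = fwd xRz ◅ TransClosure⇒EqClosure z⁺y

weight-Connected : ∀ {d} {v w : Λ d} → Connected v w → + weight v ≡ + weight w mod d
weight-Connected {d} = gfold (≡-mod-isEquivalence d) (λ v → + weight v) weight-⋖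

InΛ-exists : ∀ {d} .{{_ : NonZero d}} (v : Λ d) → ∃ λ (k : Fin d) → InΛ k v
InΛ-exists {d} v = ix-surjective-mod d (+ weight v)

InΛ-resp-Connected : ∀ {d} {k : Fin d} {v w : Λ d} → Connected v w → InΛ k v → InΛ k w
InΛ-resp-Connected {d} {k} {v} {w} v~w =
  ≡-mod-trans {d} {+ weight w} {+ weight v} {ix k}
    (≡-mod-sym {d} {+ weight v} {+ weight w} (weight-Connected v~w))

InΛ-unique : ∀ {d} {k k′ : Fin d} {v w : Λ d} → InΛ k v → InΛ k′ w → Connected v w → k ≡ k′
InΛ-unique {d} {k} {k′} {v} {w} k∋v k′∋w v~w = ix-injective-mod
  (≡-mod-trans {d} {ix k} {+ weight v} {ix k′} (≡-mod-sym {d} {+ weight v} {ix k} k∋v)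
    (InΛ-resp-Connected {k = k′} {w} {v} (EqClosure-sym _⋖_ v~w) k′∋w))

e∈InΛ : ∀ {d} (c : Fin d) → InΛ c (e c)
e∈InΛ {d} c = subst (λ t → + t ≡ ix c mod d) (sym (weight-e c)) (≡-mod-refl {d} {ix c})

Λ-induction : ∀ {d} (P : Λ d → Set) → (∀ {v w} → v ≗ w → P v → P w) →
  P (λ _ → 0) → (∀ v c → P v → P (v ⊕ e c)) → ∀ v → P v
Λ-induction {zero}  P resp base step v = resp (λ ()) base
Λ-induction {suc n} P resp base step v =
  resp head∷tail (Λ-induction (λ w → ∀ m → P (m ∷ᶠ w)) resp′ base′ step′ (tail v) (head v))
  where
  head∷tail : (head v ∷ᶠ tail v) ≗ v
  head∷tail zero    = refl
  head∷tail (suc l) = refl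
  resp′ : ∀ {w w′} → w ≗ w′ → (∀ m → P (m ∷ᶠ w)) → ∀ m → P (m ∷ᶠ w′)
  resp′ w≗w′ P[∷w] m = resp (λ { zero → refl ; (suc l) → w≗w′ l }) (P[∷w] m)
  base′ : ∀ m → P (m ∷ᶠ λ _ → 0)
  base′ zero    = resp (λ { zero → refl ; (suc l) → refl }) base
  base′ (suc m) = resp (λ { zero → ℕP.+-comm m 1 ; (suc l) → refl }) (step _ zero (base′ m))
  step′ : ∀ w c → (∀ m → P (m ∷ᶠ w)) → ∀ m → P (m ∷ᶠ (w ⊕ e c))
  step′ w c P[∷w] m =
    resp (λ { zero → ℕP.+-identityʳ m ; (suc l) → refl }) (step _ (suc c) (P[∷w] m))

-- The step e(d) − e(d) − e(d), admissible because d ∣ d − d − d.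
⋖-⊕e-last : ∀ {n} {v w : Λ (suc n)} → (∀ l → v l ℕ.+ e (fromℕ n) l ≡ w l) → v ⋖ w
⋖-⊕e-last {n} v+eL≗w = ⋖-intro L L L L≡L+L (λ l → cong (ℕ._+ e L l) (v+eL≗w l))
  where
  L = fromℕ n
  -x≡-1*x : ∀ x → x - (x + x) ≡ (- + 1) * x
  -x≡-1*x = solve-∀
  L≡L+L : ix L ≡ ix L + ix L mod suc n
  L≡L+L = S.∣⇒∣ᵤ (S.divides (- + 1)
    (trans (-x≡-1*x (ix L)) (cong (λ t → (- + 1) * + suc t) (FP.toℕ-fromℕ n))))

≗⇒Connected : ∀ {n} {v w : Λ (suc n)} → v ≗ w → Connected v w
≗⇒Connected {n} {v} {w} v≗w = v~u ◅◅ EqClosure-sym _⋖_ w~u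
  where
  u = v ⊕ e (fromℕ n)
  v~u : Connected v u
  v~u = return (⋖-⊕e-last {v = v} {u} (λ _ → refl))
  w~u : Connected w u
  w~u = return (⋖-⊕e-last {v = w} {u} (λ l → cong (ℕ._+ e (fromℕ n) l) (sym (v≗w l))))

Connected-to-basis : ∀ {n} (v : Λ (suc n)) → ∃ λ c → Connected v (e c)
Connected-to-basis {n} = Λ-induction (λ v → ∃ λ c → Connected v (e c))
  (λ { v≗w (c , v~c) → c , ≗⇒Connected (sym ∘ v≗w) ◅◅ v~c })
  (fromℕ n , return (⋖-⊕e-last {v = λ _ → 0} {e (fromℕ n)} (λ _ → refl)))
  step
  where
  step : ∀ v b → (∃ λ c → Connected v (e c)) → ∃ λ c → Connected (v ⊕ e b) (e c)
  step v b (c , v~c) =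
    a , gmap (_⊕ e b) (λ {x} {y} → ⋖-translate {v = x} {y} (e b)) v~c ◅◅ c+b~a
    where
    a = proj₁ (ix-surjective-mod (suc n) (ix c + ix b))
    a≡c+b = ≡-mod-sym {suc n} {ix c + ix b} {ix a}
      (proj₂ (ix-surjective-mod (suc n) (ix c + ix b)))
    merge : ∀ l → e a l ℕ.+ e c l ℕ.+ e b l ≡ (e c ⊕ e b) l ℕ.+ e a l
    merge l = trans (ℕP.+-assoc (e a l) _ _) (ℕP.+-comm (e a l) _)
    c+b~a : Connected (e c ⊕ e b) (e a)
    c+b~a = EqClosure-sym _⋖_ (return (⋖-intro {v = e a} {e c ⊕ e b} a c b a≡c+b merge))

InΛ⇒Connected-e : ∀ {n} {k : Fin (suc n)} {v} → InΛ k v → Connected v (e k)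
InΛ⇒Connected-e {k = k} {v} k∋v with Connected-to-basis v
... | c , v~c = subst (Connected v ∘ e) (InΛ-unique (e∈InΛ c) k∋v (EqClosure-sym _⋖_ v~c)) v~c

InΛ⇒Connected : ∀ {n} {k : Fin (suc n)} {v w} → InΛ k v → InΛ k w → Connected v w
InΛ⇒Connected k∋v k∋w = InΛ⇒Connected-e k∋v ◅◅ EqClosure-sym _⋖_ (InΛ⇒Connected-e k∋w)

Decomposition : {X : Set} → Rel X 0ℓ → (X → Set) → Set₁
Decomposition {X} _<_ P = Σ (X → Set) λ A → Σ (X → Set) λ B →
  (∀ v → A v → P v) × (∀ v → B v → P v)
  × (∀ v → P v → A v ⊎ B v)
  × (∀ v → A v → B v → ⊥)
  × (∃ λ v → A v) × (∃ λ v → B v)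
  × (∀ v w → A v → B w → ¬ (v < w ⊎ w < v))

connected⇒¬Decomposition : ∀ {X : Set} {R : Rel X 0ℓ} (P : X → Set) →
  (∀ {x y} → EqClosure R x y → P x → P y) → (∀ {x y} → P x → P y → EqClosure R x y) →
  ¬ Decomposition (TransClosure R) P
connected⇒¬Decomposition {R = R} P P-closed P-connected
  (A , B , A⊆P , B⊆P , P⊆A∪B , A∩B=∅ , (a , a∈A) , (b , b∈B) , incomparable) =
  A∩B=∅ b (Equivalence.to (A-invariant (P-connected (A⊆P a a∈A) (B⊆P b b∈B))) a∈A) b∈B
  where
  A-step : ∀ {x y} → R x y → A x ⇔ A y
  A-step {x} {y} xRy = mk⇔ forward backward
    where
    forward : A x → A y
    forward x∈A with P⊆A∪B y (P-closed (return xRy) (A⊆P x x∈A))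
    ... | inj₁ y∈A = y∈A
    ... | inj₂ y∈B = ⊥-elim (incomparable x y x∈A y∈B (inj₁ [ xRy ]))
    backward : A y → A x
    backward y∈A with P⊆A∪B x (P-closed (EqClosure-sym R (return xRy)) (A⊆P y y∈A))
    ... | inj₁ x∈A = x∈A
    ... | inj₂ x∈B = ⊥-elim (incomparable y x y∈A x∈B (inj₂ [ xRy ]))
  A-invariant : ∀ {x y} → EqClosure R x y → A x ⇔ A y
  A-invariant = gfold ⇔-isEquivalence A A-step

comparable⇒Connected : ∀ {d} {v w : Λ d} → v ≺ w ⊎ w ≺ v → Connected v w
comparable⇒Connected (inj₁ v≺w) = TransClosure⇒EqClosure v≺w
comparable⇒Connected (inj₂ w≺v) = EqClosure-sym _⋖_ (TransClosure⇒EqClosure w≺v)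

proposition2p2 : (d : ℕ) → 0 < d →
    ((∀ (v : Λ d) → ∃ λ (k : Fin d) → InΛ k v)
     × (∀ (v : Λ d) (k k′ : Fin d) → InΛ k v → InΛ k′ v → k ≡ k′)
     × (∀ (k k′ : Fin d) (v w : Λ d) → k ≢ k′ → InΛ k v → InΛ k′ w →
          ¬ (v ≺ w ⊎ w ≺ v)))
    ×
    (∀ (k : Fin d) → ¬ (Σ (Λ d → Set) λ A → Σ (Λ d → Set) λ B →
        (∀ v → A v → InΛ k v) × (∀ v → B v → InΛ k v)
        × (∀ v → InΛ k v → A v ⊎ B v)
        × (∀ v → A v → B v → ⊥)
        × (∃ λ v → A v) × (∃ λ v → B v)
        × (∀ v w → A v → B w → ¬ (v ≺ w ⊎ w ≺ v))))
proposition2p2 (suc n) _ =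
  ( InΛ-exists
  , (λ v k k′ k∋v k′∋v → InΛ-unique {k = k} {k′} {v} {v} k∋v k′∋v ε)
  , λ k k′ v w k≢k′ k∋v k′∋w v≺w⊎w≺v →
      k≢k′ (InΛ-unique k∋v k′∋w (comparable⇒Connected v≺w⊎w≺v)))
  , λ k → connected⇒¬Decomposition (InΛ k) InΛ-resp-Connected InΛ⇒Connected
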